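{- Let $A$ be a justified AJM game and $\phi$ a skeleton on $A$ (in the general sense). Then $\phi^\bullet=\{t\mid \exists s\in\phi.\ s\approx_A t\}$ is a strategy on $A$, and $\phi$ is a skeleton of $\phi^\bullet$.
   Context: A justified AJM game $A=(M_A,\lambda_A,\mathsf{j}_A,P_A,\approx_A)$: set of moves $M_A$; labelling $\lambda_A:M_A\to\{P,O\}\times\{Q,A\}$; a partial justification function (well-founded; P-moves justified by O-moves and vice versa; answers justified by questions); a non-empty prefix-closed set $P_A$ of finite move sequences (plays) which start with an O-move, alternate O/P, contain each move at most once, are prefixes of well-bracketed strings, and contain the justifier of each move earlier; an equivalence $\approx_A$ on $P_A$ such that (e1) $s\approx_A t$ implies equal label sequences, (e2) equal-length prefixes of equivalent plays are equivalent, (e3) $s\approx_A t$, $sa\in P_A$ imply $sa\approx_A tb$ for some $b$. A strategy on $A$: a non-empty set $\sigma$ of even-length plays with Causal Consistency ($sab\in\sigma\Rightarrow s\in\sigma$), Representation Independence ($s\in\sigma$, $s\approx_A t\Rightarrow t\in\sigma$), Determinacy ($sab,ta'b'\in\sigma$, $sa\approx_A ta'\Rightarrow sab\approx_A ta'b'$). A skeleton (general sense) is a non-empty, causally consistent set $\phi$ of even-length plays satisfying Functional Determinacy ($sab,sac\in\phi\Rightarrow b=c$) and Functional Representation Independence (if $sab\in\phi$, $t\in\phi$, $sa\approx_A ta'$ then there is a unique $b'$ with $ta'b'\in\phi$ and $sab\approx_A ta'b'$). A skeleton of a strategy $\sigma$ is a non-empty causally consistent subset $\phi\subseteq\sigma$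 satisfying Uniformization: for all $sab\in\sigma$ with $s\in\phi$ there is a unique $b'$ with $sab'\in\phi$. -}

module Defs where

open import Data.Empty using (⊥)
open import Data.Unit using (⊤)
open import Data.Nat using (ℕ)
open import Data.List using (List; []; _∷_; _++_; [_]; map; length)
open import Data.List.Membership.Propositional using (_∈_)
open import Data.List.Relation.Unary.Unique.Propositional using (Unique)
open import Data.Maybe using (Maybe; just; nothing)
open import Data.Product using (Σ; ∃; ∃!; _×_; _,_; proj₁; proj₂)
open import Induction.WellFounded using (WellFounded)
open import Relation.Binary.PropositionalEquality using (_≡_; _≢_)

data Pol : Set where
  O P : Pol

data Kind : Set where
  Q A : Kind

flipPol : Pol → Pol
flipPol O = P
flipPol P = O

data Even : ℕ → Set where
  ev0  : Even 0
  ev+2 : ∀ {n} → Even n → Even (ℕ.suc (ℕ.suc n))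

module Arena {M : Set} (lab : M → Pol × Kind) (j : M → Maybe M) where

  pol : M → Pol
  pol m = proj₁ (lab m)

  kind : M → Kind
  kind m = proj₂ (lab m)

  AltFrom : Pol → List M → Set
  AltFrom p []      = ⊤
  AltFrom p (m ∷ s) = (pol m ≡ p) × AltFrom (flipPol p) s

  data WB : List M → Set where
    wb-nil : WB []
    wb-app : ∀ {u v} → WB u → WB v → WB (u ++ v)
    wb-br  : ∀ {q a u} → kind q ≡ Q → kind a ≡ A → j a ≡ just q →
             WB u → WB (q ∷ (u ++ [ a ]))

  JustifiersEarlier : List M → Set
  JustifiersEarlier s = ∀ s₁ a s₂ b → s ≡ s₁ ++ (a ∷ s₂) → j a ≡ just b → b ∈ s₁

  Legal : List M → Set
  Legal s = AltFrom O s × Unique s × (∃ λ t → WB (s ++ t)) × JustifiersEarlier s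

record Game : Set₁ where
  field
    M     : Set
    lab   : M → Pol × Kind
    j     : M → Maybe M
  open Arena lab j public
  field
    j-wf   : WellFounded (λ b a → j a ≡ just b)
    j-pol  : ∀ {a b} → j a ≡ just b → pol b ≢ pol a
    j-ans  : ∀ {a b} → j a ≡ just b → kind a ≡ A → kind b ≡ Q
    Plays      : List M → Set
    P-nonempty : ∃ λ s → Plays s
    P-prefix   : ∀ {s t} → Plays (s ++ t) → Plays s
    P-legal    : ∀ {s} → Plays s → Legal s
    _≈_    : List M → List M → Set
    ≈-dom   : ∀ {s t} → s ≈ t → Plays s × Plays t
    ≈-refl  : ∀ {s} → Plays s → s ≈ s
    ≈-sym   : ∀ {s t} → s ≈ t → t ≈ s
    ≈-trans : ∀ {s t u} → s ≈ t → t ≈ u → s ≈ u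
    e1 : ∀ {s t} → s ≈ t → map lab s ≡ map lab t
    e2 : ∀ {s s' t t'} → (s ++ s') ≈ (t ++ t') → length s ≡ length t → s ≈ t
    e3 : ∀ {s t a} → s ≈ t → Plays (s ++ [ a ]) → ∃ λ b → (s ++ [ a ]) ≈ (t ++ [ b ])

module _ (G : Game) where
  open Game G

  record IsStrategy (σ : List M → Set) : Set where
    field
      nonempty : ∃ λ s → σ s
      plays    : ∀ {s} → σ s → Plays s × Even (length s)
      causal   : ∀ {s a b} → σ (s ++ a ∷ b ∷ []) → σ s
      repInd   : ∀ {s t} → σ s → s ≈ t → σ t
      determ   : ∀ {s a b t a' b'} → σ (s ++ a ∷ b ∷ []) → σ (t ++ a' ∷ b' ∷ []) →
                 (s ++ [ a ]) ≈ (t ++ [ a' ]) →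
                 (s ++ a ∷ b ∷ []) ≈ (t ++ a' ∷ b' ∷ [])

  record IsSkeleton (φ : List M → Set) : Set where
    field
      nonempty : ∃ λ s → φ s
      plays    : ∀ {s} → φ s → Plays s × Even (length s)
      causal   : ∀ {s a b} → φ (s ++ a ∷ b ∷ []) → φ s
      funDet   : ∀ {s a b c} → φ (s ++ a ∷ b ∷ []) → φ (s ++ a ∷ c ∷ []) → b ≡ c
      funRepInd : ∀ {s a b t a'} → φ (s ++ a ∷ b ∷ []) → φ t →
                  (s ++ [ a ]) ≈ (t ++ [ a' ]) →
                  ∃! _≡_ (λ b' → φ (t ++ a' ∷ b' ∷ []) ×
                                 (s ++ a ∷ b ∷ []) ≈ (t ++ a' ∷ b' ∷ []))

  record IsSkeletonOf (σ φ : List M → Set) : Set where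
    field
      nonempty : ∃ λ s → φ s
      subset   : ∀ {s} → φ s → σ s
      causal   : ∀ {s a b} → φ (s ++ a ∷ b ∷ []) → φ s
      uniform  : ∀ {s a b} → σ (s ++ a ∷ b ∷ []) → φ s →
                 ∃! _≡_ (λ b' → φ (s ++ a ∷ b' ∷ []))

  bullet : (List M → Set) → List M → Set
  bullet φ t = ∃ λ s → φ s × (s ≈ t)

-- Everything rests on one structural fact about the game: a play u equivalent
-- to s·a·b has the shape u₀·x·y with u₀·x ≈ s·a and u₀ ≈ s (equivalent plays
-- have equal length by (e1), and (e2) transports equivalence to equal-length
-- prefixes).  So every element of φ• of the form s·a·b is represented in φ by
-- some u₀·x·y whose prefixes are equivalent to those of s·a·b.
--
-- From the skeleton axioms we then derive two facts about φ itself: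
--   * determinacy up to ≈: two plays of φ whose O-prefixes are equivalent are
--     equivalent (Functional Representation Independence + Functional
--     Determinacy);
--   * responsiveness: if u₀·x·y ∈ φ, t ∈ φ and u₀·x ≈ t·a, then φ answers t·a.
-- The strategy axioms for φ• (causal consistency, representation independence,
-- determinacy) and the uniformization property of φ inside φ• then follow by
-- decomposing the representatives and applying these two facts.
module Submission where

open import Defs
open import Data.List using (List; []; _∷_; _++_; [_]; length)
open import Data.List.Properties using (++-assoc; length-++; length-map)
open import Data.Nat using (ℕ; zero; suc; _+_)
open import Data.Nat.Properties using (suc-injective)
open import Data.Product using (_×_; _,_; Σ; ∃; ∃!; proj₁; proj₂)
open import Relation.Binary.PropositionalEquality
  using (_≡_; refl; sym; trans; cong; subst; subst₂)

splitLastTwo : ∀ {X : Set} (n : ℕ) (u : List X) → length u ≡ n + 2 →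
  Σ (List X) λ u₀ → Σ X λ x → Σ X λ y → (u ≡ u₀ ++ x ∷ y ∷ []) × (length u₀ ≡ n)
splitLastTwo zero    (x ∷ y ∷ []) refl = [] , x , y , refl , refl
splitLastTwo (suc n) (z ∷ u) eq with splitLastTwo n u (suc-injective eq)
... | u₀ , x , y , refl , len = z ∷ u₀ , x , y , refl , cong suc len

module GameFacts (G : Game) where
  open Game G

  -- Equivalent plays have the same length, since they have the same labels (e1).
  ≈-length : ∀ {s t} → s ≈ t → length s ≡ length t
  ≈-length {s} {t} e =
    trans (sym (length-map lab s)) (trans (cong length (e1 e)) (length-map lab t))

  record EquivLastTwo (u s : List M) (a : M) : Set where
    field
      init      : List M
      x y       : M
      shape     : u ≡ init ++ x ∷ y ∷ []
      ≈-prefix₁ : (init ++ [ x ]) ≈ (s ++ [ a ])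
      ≈-prefix₀ : init ≈ s

  equivLastTwo : ∀ {u s a b} → u ≈ (s ++ a ∷ b ∷ []) → EquivLastTwo u s a
  equivLastTwo {u} {s} {a} {b} e
    with splitLastTwo (length s) u (trans (≈-length e) (length-++ s))
  ... | u₀ , x , y , refl , len = record
    { init = u₀ ; x = x ; y = y ; shape = refl
    ; ≈-prefix₁ = prefix₁
    ; ≈-prefix₀ = e2 {s' = [ x ]} {t' = [ a ]} prefix₁ len }
    where
      reassociated : ((u₀ ++ [ x ]) ++ [ y ]) ≈ ((s ++ [ a ]) ++ [ b ])
      reassociated =
        subst₂ _≈_ (sym (++-assoc u₀ [ x ] [ y ])) (sym (++-assoc s [ a ] [ b ])) e

      prefix₁ : (u₀ ++ [ x ]) ≈ (s ++ [ a ])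
      prefix₁ = e2 reassociated
        (trans (length-++ u₀) (trans (cong (_+ 1) len) (sym (length-++ s))))

module SkeletonFacts (G : Game) (φ : List (Game.M G) → Set) (sk : IsSkeleton G φ) where
  open Game G
  open GameFacts G
  open IsSkeleton sk

  responds : ∀ {u x y t a} → φ (u ++ x ∷ y ∷ []) → φ t → (u ++ [ x ]) ≈ (t ++ [ a ]) →
             ∃ λ b → φ (t ++ a ∷ b ∷ [])
  responds p q e with funRepInd p q e
  ... | b , (r , _) , _ = b , r

  deterministic : ∀ {u x y v x' y'} → φ (u ++ x ∷ y ∷ []) → φ (v ++ x' ∷ y' ∷ []) →
                  (u ++ [ x ]) ≈ (v ++ [ x' ]) →
                  (u ++ x ∷ y ∷ []) ≈ (v ++ x' ∷ y' ∷ [])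
  deterministic p q e with funRepInd p (causal q) e
  ... | b , (r , equiv) , _ with funDet r q
  ... | refl = equiv

  φ• : List M → Set
  φ• = bullet G φ

  φ⊆φ• : ∀ {s} → φ s → φ• s
  φ⊆φ• p = _ , p , ≈-refl (proj₁ (plays p))

  -- φ• consists of even-length plays: both properties are invariant under ≈.
  φ•-plays : ∀ {t} → φ• t → Plays t × Even (length t)
  φ•-plays (s , p , e) = proj₂ (≈-dom e) , subst Even (≈-length e) (proj₂ (plays p))

  -- Causal consistency of φ•: truncate the representative in φ.
  φ•-causal : ∀ {s a b} → φ• (s ++ a ∷ b ∷ []) → φ• s
  φ•-causal (u , p , e) = init , causal (subst φ shape p) , ≈-prefix₀
    where open EquivLastTwo (equivLastTwo e)

  φ•-repInd : ∀ {s t} → φ• s → s ≈ t → φ• t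
  φ•-repInd (u , p , e) e' = u , p , ≈-trans e e'

  -- Determinacy of φ•: compare the two representatives in φ.
  φ•-determ : ∀ {s a b t a' b'} → φ• (s ++ a ∷ b ∷ []) → φ• (t ++ a' ∷ b' ∷ []) →
              (s ++ [ a ]) ≈ (t ++ [ a' ]) → (s ++ a ∷ b ∷ []) ≈ (t ++ a' ∷ b' ∷ [])
  φ•-determ (u , p , e) (v , q , f) h with equivLastTwo e | equivLastTwo f
  ... | record { shape = refl ; ≈-prefix₁ = eu } | record { shape = refl ; ≈-prefix₁ = ev } =
    ≈-trans (≈-sym e)
      (≈-trans (deterministic p q (≈-trans eu (≈-trans h (≈-sym ev)))) f)

  φ-uniform : ∀ {s a b} → φ• (s ++ a ∷ b ∷ []) → φ s → ∃! _≡_ (λ b' → φ (s ++ a ∷ b' ∷ []))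
  φ-uniform (u , p , e) ps with equivLastTwo e
  ... | record { shape = refl ; ≈-prefix₁ = eu } with responds p ps eu
  ... | b' , q = b' , q , funDet q

mainTheorem11 : (G : Game) (φ : List (Game.M G) → Set) →
    IsSkeleton G φ → IsStrategy G (bullet G φ) × IsSkeletonOf G (bullet G φ) φ
mainTheorem11 G φ sk = strategy , skeletonOf
  where
    open SkeletonFacts G φ sk
    open IsSkeleton sk using (nonempty; causal)

    strategy : IsStrategy G φ•
    strategy = record
      { nonempty = proj₁ nonempty , φ⊆φ• (proj₂ nonempty)
      ; plays    = φ•-plays
      ; causal   = φ•-causal
      ; repInd   = φ•-repInd
      ; determ   = φ•-determ
      }

    skeletonOf : IsSkeletonOf G φ• φ
    skeletonOf = record
      { nonempty = nonempty
      ; subset   = φ⊆φ•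
      ; causal   = causal
      ; uniform  = φ-uniform
      }
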